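{- Let $\mathcal{S}=(a_1,\dots,a_n)$ be a reducible signature of $Q_n$ and let $R$ be a reducing set for $\mathcal{S}$. Let $T$ be an upright spanning tree of $Q_n$ with signature $\mathcal{S}$ and let $X$ be a nonempty subset of $[n]$. Then $\psi_T(X)\in R$ if and only if $X\subseteq R$.
   Context: $[n]=\{1,\dots,n\}$. $Q_n$: vertices the subsets of $[n]$, edge between $X,Y$ iff $X\oplus Y=\{i\}$ for a single $i$ (the direction). The signature of a spanning tree $T$ is $(a_1,\dots,a_n)$ with $a_i$ the number of edges of $T$ in direction $i$. A signature is reducible if there is a proper nonempty $R\subseteq[n]$ (a reducing set) with $\sum_{i\in R}a_i=2^{|R|}-1$. A spanning tree $T$ rooted at $\emptyset$ is upright if for each vertex $X$ the path in $T$ from $X$ to $\emptyset$ has length $|X|$; then for nonempty $X$ the next vertex on this path is $X-\{i\}$ for a unique $i$, and $\psi_T(X)=i$. -}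

module Defs where

open import Data.Nat using (ℕ; zero; suc; _+_; _∸_; _^_; _≤_)
open import Data.Fin using (Fin)
open import Data.Fin.Properties using () renaming (_≟_ to _≟ᶠ_)
open import Data.Fin.Subset using (Subset; ⊥; ⁅_⁆; _∪_; _-_; _∈_; _∉_; _⊆_; ∣_∣; Nonempty)
open import Data.Fin.Subset.Properties using (_∈?_)
open import Data.List using (List; []; _∷_; _++_; length; filter; map; allFin)
open import Data.Nat.ListAction using (sum)
open import Data.List.Membership.Propositional using () renaming (_∈_ to _∈ₗ_)
open import Data.List.Relation.Unary.All using (All)
open import Data.List.Relation.Unary.Unique.Propositional using (Unique)
open import Data.Product using (Σ; ∃; _×_; _,_; proj₁; proj₂)
open import Data.Sum using (_⊎_)
open import Data.Bool using (if_then_else_)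
open import Relation.Nullary using (¬_)
open import Relation.Nullary.Decidable using (⌊_⌋)
open import Relation.Binary.PropositionalEquality using (_≡_)

-- An edge of Q_n, in canonical form (X , i) with i ∉ X: it joins the
-- vertices X and X ∪ {i}; its direction is i.
Edge : ℕ → Set
Edge n = Subset n × Fin n

direction : ∀ {n} → Edge n → Fin n
direction = proj₂

ValidEdge : ∀ {n} → Edge n → Set
ValidEdge (X , i) = i ∉ X

Graph : ℕ → Set
Graph n = List (Edge n)

Adj : ∀ {n} → Graph n → Subset n → Subset n → Set
Adj T X Y = ∃ λ i → ((X , i) ∈ₗ T × Y ≡ X ∪ ⁅ i ⁆) ⊎ ((Y , i) ∈ₗ T × X ≡ Y ∪ ⁅ i ⁆)

-- Walk T X ws Y : X, ws₁, …, wsₖ is a walk in T ending at Y (length = length ws).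
Walk : ∀ {n} → Graph n → Subset n → List (Subset n) → Subset n → Set
Walk T X []       Y = X ≡ Y
Walk T X (Z ∷ ws) Y = Adj T X Z × Walk T Z ws Y

Connected : ∀ {n} → Graph n → Set
Connected T = ∀ X Y → ∃ λ ws → Walk T X ws Y

-- a cycle X, w₁, …, wₖ, X with k ≥ 2 (so ≥ 3 vertices) and distinct vertices
HasCycle : ∀ {n} → Graph n → Set
HasCycle T = ∃ λ X → ∃ λ ws →
  Unique (X ∷ ws) × 2 ≤ length ws × Walk T X (ws ++ X ∷ []) X

SpanningTree : ∀ {n} → Graph n → Set
SpanningTree T = All ValidEdge T × Unique T × Connected T × ¬ HasCycle T

signature : ∀ {n} → Graph n → Fin n → ℕ
signature T i = length (filter (λ e → direction e ≟ᶠ i) T)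

sumOver : ∀ {n} → Subset n → (Fin n → ℕ) → ℕ
sumOver {n} R a = sum (map (λ i → if ⌊ i ∈? R ⌋ then a i else 0) (allFin n))

ReducingSet : ∀ {n} → (Fin n → ℕ) → Subset n → Set
ReducingSet a R = Nonempty R × (∃ λ i → i ∉ R) × sumOver R a ≡ 2 ^ ∣ R ∣ ∸ 1

Reducible : ∀ {n} → (Fin n → ℕ) → Set
Reducible a = ∃ λ R → ReducingSet a R

Upright : ∀ {n} → Graph n → Set
Upright T = ∀ X → ∃ λ ws → Walk T X ws ⊥ × length ws ≡ ∣ X ∣

-- ψ_T(X) = i : the vertex after X on the path (of length |X|) in T from X to ∅
-- is X - {i}.
Psi : ∀ {n} → Graph n → Subset n → Fin n → Set
Psi T X i = ∃ λ ws → Walk T X ((X - i) ∷ ws) ⊥ × length ((X - i) ∷ ws) ≡ ∣ X ∣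

-- In an upright tree the path from a nonempty Y to ∅ first steps down, so every nonempty Y is the
-- upper end Z ∪ {j} of an edge (Z , j) of T, and j ∈ Y.  Hence the edges of T in directions from R
-- have among their upper ends all 2^|R| - 1 nonempty subsets of R.  For a reducing set R there are
-- exactly 2^|R| - 1 such edges, so no upper end lies outside R.  The edge (X - ψ(X) , ψ(X)) has
-- upper end X, so ψ(X) ∈ R forces X ⊆ R; conversely ψ(X) ∈ X.
module Submission where

open import Defs
open import Data.Nat using (ℕ; suc; _+_; _∸_; _^_; _≤_; _<_; z≤n; s≤s; s≤s⁻¹)
open import Data.Nat.Properties
  using (≤-trans; ≤-reflexive; m≤n⇒m≤1+n; n<1+n; <-irrefl; +-comm; +-suc; +-identityʳ;
         +-monoʳ-≤; n≤1+n; m^n>0; ∸-monoʳ-<; +-commutativeSemigroup; module ≤-Reasoning)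
open import Algebra.Properties.CommutativeSemigroup +-commutativeSemigroup using (interchange)
open import Data.Nat.ListAction using (sum)
open import Data.Fin using (Fin)
open import Data.Fin.Properties using () renaming (_≟_ to _≟ᶠ_)
open import Data.Fin.Subset
  using (Subset; _∈_; _⊆_; _⊂_; Nonempty; ⊥; ⁅_⁆; _∪_; _-_; ∣_∣; inside; outside)
open import Data.Fin.Subset.Properties
  using (_∈?_; _⊆?_; nonempty?; Empty-unique; ∉⊥; x∈⁅x⁆; p⊆p∪q; q⊆p∪q; ∣p∣≤∣p∪q∣; ∣⁅x⁆∣≡1;
         ∣⊥∣≡0; p⊂q⇒∣p∣<∣q∣; x∈p∧x≢y⇒x∈p-y; p─q⊆p; out⊆; in⊆in)
open import Data.Bool using (if_then_else_)
open import Data.Bool.Properties using (if-eta)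
open import Data.Vec using ([]; _∷_)
open import Data.Vec.Properties using (∷-injectiveʳ)
open import Data.List using (List; []; _∷_; [_]; _++_; length; filter; map; allFin)
open import Data.List.Properties using (length-map; length-++; length-removeAt′; map-cong)
open import Data.List.Relation.Unary.Any using (here; there; index; _─_)
open import Data.List.Relation.Unary.All as All using (All; []; _∷_)
open import Data.List.Relation.Unary.AllPairs using ([]; _∷_)
open import Data.List.Relation.Unary.Unique.Propositional using (Unique)
open import Data.List.Relation.Unary.Unique.Propositional.Properties using (map⁺; ++⁺; allFin⁺)
open import Data.List.Relation.Binary.Subset.Propositional using () renaming (_⊆_ to _⊆ₗ_)
open import Data.List.Membership.Propositional using () renaming (_∈_ to _∈ₗ_)
open import Data.List.Membership.Propositional.Properties
  using (∈-map⁺; ∈-map⁻; ∈-filter⁺; ∈-++⁻; ∈-allFin)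
open import Data.Product using (∃; _×_; _,_; proj₁; proj₂)
open import Data.Sum using (inj₁; inj₂)
open import Data.Empty using (⊥-elim)
open import Relation.Nullary using (¬_; yes; no)
open import Relation.Nullary.Decidable using (⌊_⌋; decidable-stable)
open import Function.Bundles using (_⇔_; mk⇔)
open import Relation.Binary.PropositionalEquality
  using (_≡_; refl; sym; trans; cong; cong₂; subst; _≢_; module ≡-Reasoning)

module _ {A : Set} where

  ∈-─⁺ : ∀ {x y : A} {xs} (x∈xs : x ∈ₗ xs) → y ∈ₗ xs → x ≢ y → y ∈ₗ (xs ─ x∈xs)
  ∈-─⁺ (here refl) (here refl) x≢y = ⊥-elim (x≢y refl)
  ∈-─⁺ (here refl) (there y∈xs) _  = y∈xs
  ∈-─⁺ (there _)   (here refl) _   = here refl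
  ∈-─⁺ (there x∈xs) (there y∈xs) x≢y = there (∈-─⁺ x∈xs y∈xs x≢y)

  unique⊆⇒length≤ : ∀ {xs ys : List A} → Unique xs → xs ⊆ₗ ys → length xs ≤ length ys
  unique⊆⇒length≤ {[]}     _              _     = z≤n
  unique⊆⇒length≤ {x ∷ xs} {ys} (x∉xs ∷ xs!) xs⊆ys =
    subst (suc (length xs) ≤_) (sym (length-removeAt′ ys (index x∈ys)))
      (s≤s (unique⊆⇒length≤ xs! (λ y∈xs → ∈-─⁺ x∈ys (xs⊆ys (there y∈xs)) (All.lookup x∉xs y∈xs))))
    where x∈ys = xs⊆ys (here refl)

subsets : ∀ {n} → Subset n → List (Subset n)
subsets []            = [ [] ]
subsets (outside ∷ p) = map (outside ∷_) (subsets p)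
subsets (inside ∷ p)  = map (outside ∷_) (subsets p) ++ map (inside ∷_) (subsets p)

length-subsets : ∀ {n} (p : Subset n) → length (subsets p) ≡ 2 ^ ∣ p ∣
length-subsets []            = refl
length-subsets (outside ∷ p) = trans (length-map (outside ∷_) (subsets p)) (length-subsets p)
length-subsets (inside ∷ p)  = begin
  length (map (outside ∷_) (subsets p) ++ map (inside ∷_) (subsets p))
    ≡⟨ length-++ (map (outside ∷_) (subsets p)) ⟩
  length (map (outside ∷_) (subsets p)) + length (map (inside ∷_) (subsets p))
    ≡⟨ cong₂ _+_ (length-map (outside ∷_) (subsets p)) (length-map (inside ∷_) (subsets p)) ⟩
  length (subsets p) + length (subsets p)
    ≡⟨ cong₂ _+_ (length-subsets p) (trans (length-subsets p) (sym (+-identityʳ _))) ⟩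
  2 ^ suc ∣ p ∣ ∎
  where open ≡-Reasoning

subsets-unique : ∀ {n} (p : Subset n) → Unique (subsets p)
subsets-unique []            = [] ∷ []
subsets-unique (outside ∷ p) = map⁺ ∷-injectiveʳ (subsets-unique p)
subsets-unique (inside ∷ p)  =
  ++⁺ (map⁺ ∷-injectiveʳ (subsets-unique p)) (map⁺ ∷-injectiveʳ (subsets-unique p)) disjoint
  where
  disjoint : ∀ {q} → ¬ (q ∈ₗ map (outside ∷_) (subsets p) × q ∈ₗ map (inside ∷_) (subsets p))
  disjoint (q∈outs , q∈ins) with ∈-map⁻ (outside ∷_) q∈outs | ∈-map⁻ (inside ∷_) q∈ins
  ... | _ , _ , refl | _ , _ , ()

∈-subsets⁻ : ∀ {n} {q p : Subset n} → q ∈ₗ subsets p → q ⊆ p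
∈-subsets⁻ {p = []} (here refl) = λ ()
∈-subsets⁻ {p = outside ∷ p} q∈ with _ , q′∈ , refl ← ∈-map⁻ (outside ∷_) q∈ = out⊆ (∈-subsets⁻ q′∈)
∈-subsets⁻ {p = inside ∷ p} q∈ with ∈-++⁻ (map (outside ∷_) (subsets p)) q∈
... | inj₁ q∈outs with _ , q′∈ , refl ← ∈-map⁻ (outside ∷_) q∈outs = out⊆ (∈-subsets⁻ q′∈)
... | inj₂ q∈ins  with _ , q′∈ , refl ← ∈-map⁻ (inside ∷_) q∈ins  = in⊆in (∈-subsets⁻ q′∈)

sum-map-+ : ∀ {A : Set} (f g : A → ℕ) (xs : List A) →
  sum (map (λ x → f x + g x) xs) ≡ sum (map f xs) + sum (map g xs)
sum-map-+ f g []       = refl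
sum-map-+ f g (x ∷ xs) =
  trans (cong (f x + g x +_) (sum-map-+ f g xs)) (interchange (f x) (g x) _ _)

sum-map-zero : ∀ {A : Set} {f : A → ℕ} {xs} → All (λ x → f x ≡ 0) xs → sum (map f xs) ≡ 0
sum-map-zero []              = refl
sum-map-zero (fx≡0 ∷ fxs≡0) = cong₂ _+_ fx≡0 (sum-map-zero fxs≡0)

single : ∀ {n} → Fin n → (Fin n → ℕ) → Fin n → ℕ
single d f i = if ⌊ d ≟ᶠ i ⌋ then f i else 0

single-≢ : ∀ {n} {d i : Fin n} (f : Fin n → ℕ) → d ≢ i → single d f i ≡ 0
single-≢ {d = d} {i} f d≢i with d ≟ᶠ i
... | yes d≡i = ⊥-elim (d≢i d≡i)
... | no _    = refl

sum-single : ∀ {n} {d : Fin n} (f : Fin n → ℕ) {xs} → Unique xs → d ∈ₗ xs → sum (map (single d f) xs) ≡ f d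
sum-single {d = d} f (d∉xs ∷ _) (here refl) with d ≟ᶠ d
... | yes _   = trans (cong (f d +_) (sum-map-zero (All.map (single-≢ f) d∉xs))) (+-identityʳ (f d))
... | no d≢d = ⊥-elim (d≢d refl)
sum-single {d = d} f {x ∷ _} (x∉xs ∷ xs!) (there d∈xs) with d ≟ᶠ x
... | yes refl = ⊥-elim (All.lookup x∉xs d∈xs refl)
... | no _     = sum-single f xs! d∈xs

sumOver-cong : ∀ {n} (R : Subset n) {f g : Fin n → ℕ} → (∀ i → f i ≡ g i) → sumOver R f ≡ sumOver R g
sumOver-cong {n} R f≗g = cong sum (map-cong (λ i → cong (λ k → if ⌊ i ∈? R ⌋ then k else 0) (f≗g i)) (allFin n))

sumOver-+ : ∀ {n} (R : Subset n) (f g : Fin n → ℕ) →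
  sumOver R (λ i → f i + g i) ≡ sumOver R f + sumOver R g
sumOver-+ {n} R f g = trans (cong sum (map-cong split (allFin n))) (sum-map-+ _ _ (allFin n))
  where
  split : ∀ i → (if ⌊ i ∈? R ⌋ then f i + g i else 0)
              ≡ (if ⌊ i ∈? R ⌋ then f i else 0) + (if ⌊ i ∈? R ⌋ then g i else 0)
  split i with i ∈? R
  ... | yes _ = refl
  ... | no _  = refl

indicator : ∀ {n} → Subset n → Fin n → ℕ
indicator R i = if ⌊ i ∈? R ⌋ then 1 else 0

sumOver-single : ∀ {n} (R : Subset n) (d : Fin n) → sumOver R (single d (λ _ → 1)) ≡ indicator R d
sumOver-single {n} R d = trans (cong sum (map-cong swap (allFin n))) (sum-single (indicator R) (allFin⁺ n) (∈-allFin d))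
  where
  swap : ∀ i → (if ⌊ i ∈? R ⌋ then single d (λ _ → 1) i else 0) ≡ single d (indicator R) i
  swap i with d ≟ᶠ i
  ... | yes refl = refl
  ... | no _     = if-eta ⌊ i ∈? R ⌋

signature-∷ : ∀ {n} (e : Edge n) (T : Graph n) i →
  signature (e ∷ T) i ≡ single (direction e) (λ _ → 1) i + signature T i
signature-∷ e T i with direction e ≟ᶠ i
... | yes _ = refl
... | no _  = refl

edgesAlong : ∀ {n} → Subset n → Graph n → Graph n
edgesAlong R = filter (λ e → direction e ∈? R)

length-edgesAlong-∷ : ∀ {n} (R : Subset n) (e : Edge n) (T : Graph n) →
  length (edgesAlong R (e ∷ T)) ≡ indicator R (direction e) + length (edgesAlong R T)
length-edgesAlong-∷ R e T with direction e ∈? R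
... | yes _ = refl
... | no _  = refl

sumOver-signature : ∀ {n} (R : Subset n) (T : Graph n) →
  sumOver R (signature T) ≡ length (edgesAlong R T)
sumOver-signature {n} R [] = sum-map-zero (All.universal (λ i → if-eta ⌊ i ∈? R ⌋) (allFin n))
sumOver-signature R (e ∷ T) = begin
  sumOver R (signature (e ∷ T))
    ≡⟨ sumOver-cong R (signature-∷ e T) ⟩
  sumOver R (λ i → single (direction e) (λ _ → 1) i + signature T i)
    ≡⟨ sumOver-+ R _ (signature T) ⟩
  sumOver R (single (direction e) (λ _ → 1)) + sumOver R (signature T)
    ≡⟨ cong₂ _+_ (sumOver-single R (direction e)) (sumOver-signature R T) ⟩
  indicator R (direction e) + length (edgesAlong R T)
    ≡⟨ length-edgesAlong-∷ R e T ⟨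
  length (edgesAlong R (e ∷ T)) ∎
  where open ≡-Reasoning

∣p∪q∣≤∣p∣+∣q∣ : ∀ {n} (p q : Subset n) → ∣ p ∪ q ∣ ≤ ∣ p ∣ + ∣ q ∣
∣p∪q∣≤∣p∣+∣q∣ []            []            = z≤n
∣p∪q∣≤∣p∣+∣q∣ (inside ∷ p)  (inside ∷ q)  = s≤s (≤-trans (∣p∪q∣≤∣p∣+∣q∣ p q) (+-monoʳ-≤ ∣ p ∣ (n≤1+n ∣ q ∣)))
∣p∪q∣≤∣p∣+∣q∣ (inside ∷ p)  (outside ∷ q) = s≤s (∣p∪q∣≤∣p∣+∣q∣ p q)
∣p∪q∣≤∣p∣+∣q∣ (outside ∷ p) (inside ∷ q)  = subst (suc ∣ p ∪ q ∣ ≤_) (sym (+-suc ∣ p ∣ ∣ q ∣)) (s≤s (∣p∪q∣≤∣p∣+∣q∣ p q))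
∣p∪q∣≤∣p∣+∣q∣ (outside ∷ p) (outside ∷ q) = ∣p∪q∣≤∣p∣+∣q∣ p q

∣p∪⁅x⁆∣≤1+∣p∣ : ∀ {n} (p : Subset n) x → ∣ p ∪ ⁅ x ⁆ ∣ ≤ suc ∣ p ∣
∣p∪⁅x⁆∣≤1+∣p∣ p x = ≤-trans (∣p∪q∣≤∣p∣+∣q∣ p ⁅ x ⁆) (≤-reflexive (trans (cong (∣ p ∣ +_) (∣⁅x⁆∣≡1 x)) (+-comm ∣ p ∣ 1)))

Adj⇒∣X∣≤1+∣Y∣ : ∀ {n} {T : Graph n} {X Y} → Adj T X Y → ∣ X ∣ ≤ suc ∣ Y ∣
Adj⇒∣X∣≤1+∣Y∣ {X = X} (j , inj₁ (_ , refl)) = m≤n⇒m≤1+n (∣p∣≤∣p∪q∣ X ⁅ j ⁆)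
Adj⇒∣X∣≤1+∣Y∣ {Y = Y} (j , inj₂ (_ , refl)) = ∣p∪⁅x⁆∣≤1+∣p∣ Y j

Walk⊥⇒∣X∣≤length : ∀ {n} {T : Graph n} {X} ws → Walk T X ws ⊥ → ∣ X ∣ ≤ length ws
Walk⊥⇒∣X∣≤length {n} []       refl          = ≤-reflexive (∣⊥∣≡0 n)
Walk⊥⇒∣X∣≤length     (_ ∷ ws) (adj , walk) = ≤-trans (Adj⇒∣X∣≤1+∣Y∣ adj) (s≤s (Walk⊥⇒∣X∣≤length ws walk))

upper : ∀ {n} → Edge n → Subset n
upper (X , i) = X ∪ ⁅ i ⁆

direction∈upper : ∀ {n} (e : Edge n) → direction e ∈ upper e
direction∈upper (X , i) = q⊆p∪q X ⁅ i ⁆ (x∈⁅x⁆ i)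

module _ {n} {T : Graph n} (valid : All ValidEdge T) where

  Adj-minus⇒edge : ∀ {X i} → Adj T X (X - i) → (X - i , i) ∈ₗ T × X ≡ upper (X - i , i)
  Adj-minus⇒edge {X} {i} (j , inj₁ (Xj∈T , X-i≡)) =
    ⊥-elim (All.lookup valid Xj∈T (p─q⊆p X ⁅ i ⁆ (subst (j ∈_) (sym X-i≡) (direction∈upper (X , j)))))
  Adj-minus⇒edge {X} {i} (j , inj₂ (e∈T , X≡)) with j ≟ᶠ i
  ... | yes refl = e∈T , X≡
  ... | no j≢i   = ⊥-elim (All.lookup valid e∈T (x∈p∧x≢y⇒x∈p-y j∈X j≢i))
    where j∈X = subst (j ∈_) (sym X≡) (direction∈upper (X - i , j))

  Upright⇒downEdge : Upright T → ∀ {Y} → Nonempty Y → ∃ λ e → e ∈ₗ T × upper e ≡ Y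
  Upright⇒downEdge upright {Y} (x , x∈Y) with upright Y
  ... | [] , refl , _ = ⊥-elim (∉⊥ x∈Y)
  ... | (Z ∷ _) , ((j , inj₂ (e∈T , Y≡)) , _) , _ = (Z , j) , e∈T , sym Y≡
  ... | (_ ∷ ws) , ((j , inj₁ (e∈T , refl)) , walk) , len = ⊥-elim (<-irrefl refl ∣Y∣<∣Y∣)
    where
    open ≤-Reasoning
    Y⊂Y∪j : Y ⊂ Y ∪ ⁅ j ⁆
    Y⊂Y∪j = p⊆p∪q ⁅ j ⁆ , j , q⊆p∪q Y ⁅ j ⁆ (x∈⁅x⁆ j) , All.lookup valid e∈T
    ∣Y∣<∣Y∣ : ∣ Y ∣ < ∣ Y ∣
    ∣Y∣<∣Y∣ = begin-strict
      ∣ Y ∣             <⟨ p⊂q⇒∣p∣<∣q∣ Y⊂Y∪j ⟩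
      ∣ Y ∪ ⁅ j ⁆ ∣     ≤⟨ Walk⊥⇒∣X∣≤length ws walk ⟩
      length ws         <⟨ n<1+n (length ws) ⟩
      suc (length ws)   ≡⟨ len ⟩
      ∣ Y ∣             ∎

  module _ (upright : Upright T) (R : Subset n) where

    ⊆⇒∈upper-edgesAlong : ∀ {Y} → Y ⊆ R → Y ∈ₗ ⊥ ∷ map upper (edgesAlong R T)
    ⊆⇒∈upper-edgesAlong {Y} Y⊆R with nonempty? Y
    ... | no ¬Y≢∅ = here (Empty-unique ¬Y≢∅)
    ... | yes Y≢∅ with e , e∈T , upper≡Y ← Upright⇒downEdge upright Y≢∅ =
      there (subst (_∈ₗ map upper (edgesAlong R T)) upper≡Y
        (∈-map⁺ upper (∈-filter⁺ (λ e → direction e ∈? R) e∈T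
          (Y⊆R (subst (direction e ∈_) upper≡Y (direction∈upper e))))))

    upper⊆R : length (edgesAlong R T) ≡ 2 ^ ∣ R ∣ ∸ 1 →
      ∀ {e} → e ∈ₗ T → direction e ∈ R → upper e ⊆ R
    upper⊆R count {e} e∈T d∈R = decidable-stable (upper e ⊆? R) λ upper⊈R →
      <-irrefl refl (2^∣R∣<2^∣R∣ upper⊈R)
      where
      -- upper e and the subsets of R are distinct, yet all are ∅ or an upper end of an edge along R.
      2^∣R∣<2^∣R∣ : ¬ upper e ⊆ R → 2 ^ ∣ R ∣ < 2 ^ ∣ R ∣
      2^∣R∣<2^∣R∣ upper⊈R = begin-strict
        2 ^ ∣ R ∣                            ≡⟨ length-subsets R ⟨
        length (subsets R)                   ≤⟨ s≤s⁻¹ (unique⊆⇒length≤ distinct covered) ⟩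
        length (map upper (edgesAlong R T))  ≡⟨ length-map upper (edgesAlong R T) ⟩
        length (edgesAlong R T)              ≡⟨ count ⟩
        2 ^ ∣ R ∣ ∸ 1                        <⟨ ∸-monoʳ-< (s≤s z≤n) (m^n>0 2 ∣ R ∣) ⟩
        2 ^ ∣ R ∣                            ∎
        where
        open ≤-Reasoning
        distinct : Unique (upper e ∷ subsets R)
        distinct = All.tabulate (λ Y∈ upper≡Y → upper⊈R (subst (_⊆ R) (sym upper≡Y) (∈-subsets⁻ Y∈)))
                 ∷ subsets-unique R
        covered : (upper e ∷ subsets R) ⊆ₗ (⊥ ∷ map upper (edgesAlong R T))
        covered (here refl) = there (∈-map⁺ upper (∈-filter⁺ (λ e → direction e ∈? R) e∈T d∈R))
        covered (there Y∈)  = ⊆⇒∈upper-edgesAlong (∈-subsets⁻ Y∈)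

lemma5p2 : (n : ℕ) (a : Fin n → ℕ) → Reducible a →
    (R : Subset n) → ReducingSet a R →
    (T : Graph n) → SpanningTree T → Upright T → (∀ i → signature T i ≡ a i) →
    (X : Subset n) → Nonempty X →
    (i : Fin n) → Psi T X i → (i ∈ R ⇔ X ⊆ R)
lemma5p2 n a _ R (_ , _ , sumR) T (valid , _) upright sig X _ i (_ , (adj , _) , _) =
  mk⇔ i∈R⇒X⊆R X⊆R⇒i∈R
  where
  open ≡-Reasoning
  Xi∈T : (X - i , i) ∈ₗ T
  Xi∈T = proj₁ (Adj-minus⇒edge valid adj)
  X≡ : X ≡ upper (X - i , i)
  X≡ = proj₂ (Adj-minus⇒edge valid adj)
  count : length (edgesAlong R T) ≡ 2 ^ ∣ R ∣ ∸ 1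
  count = begin
    length (edgesAlong R T)  ≡⟨ sumOver-signature R T ⟨
    sumOver R (signature T)  ≡⟨ sumOver-cong R sig ⟩
    sumOver R a              ≡⟨ sumR ⟩
    2 ^ ∣ R ∣ ∸ 1            ∎
  i∈R⇒X⊆R : i ∈ R → X ⊆ R
  i∈R⇒X⊆R i∈R = subst (_⊆ R) (sym X≡) (upper⊆R valid upright R count Xi∈T i∈R)
  X⊆R⇒i∈R : X ⊆ R → i ∈ R
  X⊆R⇒i∈R X⊆R = X⊆R (subst (i ∈_) (sym X≡) (direction∈upper (X - i , i)))
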